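{- Let $G$ be a connected graph of order $n\geq 4$ whose complement $\overline{G}$ is also connected. If $G$ has at least two vertices of degree $1$, then $rd(G)\leq n-3$.
   Context: All graphs are simple, finite and undirected. For an edge-coloring of $G$ (adjacent edges may receive the same color), an edge-cut $R$ is a rainbow cut if no two edges of $R$ have the same color; it is a $u$-$v$ rainbow cut if $u$ and $v$ lie in different components of $G-R$. $G$ is rainbow disconnected if every two vertices $u,v$ have a $u$-$v$ rainbow cut. For a nontrivial connected graph $G$, $rd(G)$ is the smallest number of colors in an edge-coloring making $G$ rainbow disconnected. -}

module Defs where

open import Data.Nat using (ℕ; zero; suc; _+_)
open import Data.Fin using (Fin)
open import Data.Bool using (Bool; true; false; if_then_else_)
open import Data.List using (List; map; allFin)
open import Data.Nat.ListAction using (sum)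
open import Data.Product using (_×_; Σ; _,_)
open import Data.Sum using (_⊎_)
open import Relation.Binary.PropositionalEquality using (_≡_; _≢_)
open import Relation.Nullary using (¬_)

record Graph (n : ℕ) : Set where
  field
    adj     : Fin n → Fin n → Bool
    symm    : ∀ u v → adj u v ≡ adj v u
    irrefl  : ∀ v → adj v v ≡ false
open Graph public

data Reach {n : ℕ} (E : Fin n → Fin n → Set) : Fin n → Fin n → Set where
  here : ∀ {u} → Reach E u u
  step : ∀ {u w v} → E u w → Reach E w v → Reach E u v

Connected : ∀ {n} → Graph n → Set
Connected {n} G = ∀ (u v : Fin n) → Reach (λ a b → adj G a b ≡ true) u v

ComplAdj : ∀ {n} → Graph n → Fin n → Fin n → Set
ComplAdj G a b = (a ≢ b) × (adj G a b ≡ false)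

ComplementConnected : ∀ {n} → Graph n → Set
ComplementConnected {n} G = ∀ (u v : Fin n) → Reach (ComplAdj G) u v

degree : ∀ {n} → Graph n → Fin n → ℕ
degree {n} G x = sum (map (λ v → if adj G x v then 1 else 0) (allFin n))

-- An edge-coloring assigns a color to each ordered pair, symmetric; only
-- values on edges matter.  Colors drawn from Fin k (so at most k colors).
record EdgeColoring {n : ℕ} (G : Graph n) (k : ℕ) : Set where
  field
    col     : Fin n → Fin n → Fin k
    colSymm : ∀ u v → col u v ≡ col v u
open EdgeColoring public

record EdgeSet {n : ℕ} (G : Graph n) : Set where
  field
    mem     : Fin n → Fin n → Bool
    memSymm : ∀ u v → mem u v ≡ mem v u
    memE    : ∀ u v → mem u v ≡ true → adj G u v ≡ true
open EdgeSet public

SameEdge : ∀ {n} → Fin n → Fin n → Fin n → Fin n → Set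
SameEdge a b c d = ((a ≡ c) × (b ≡ d)) ⊎ ((a ≡ d) × (b ≡ c))

Rainbow : ∀ {n k} {G : Graph n} → EdgeColoring G k → EdgeSet G → Set
Rainbow {n} c R = ∀ (a b x y : Fin n) → mem R a b ≡ true → mem R x y ≡ true →
  col c a b ≡ col c x y → SameEdge a b x y

MinusAdj : ∀ {n} (G : Graph n) → EdgeSet G → Fin n → Fin n → Set
MinusAdj G R a b = (adj G a b ≡ true) × (mem R a b ≡ false)

RainbowCut : ∀ {n k} {G : Graph n} → EdgeColoring G k → EdgeSet G → Fin n → Fin n → Set
RainbowCut {G = G} c R u v = Rainbow c R × ¬ Reach (MinusAdj G R) u v

RainbowDisconnected : ∀ {n k} {G : Graph n} → EdgeColoring G k → Set
RainbowDisconnected {n} {G = G} c =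
  ∀ (u v : Fin n) → u ≢ v → Σ (EdgeSet G) (λ R → RainbowCut c R u v)

rd≤ : ∀ {n} → Graph n → ℕ → Set
rd≤ G k = Σ (EdgeColoring G k) RainbowDisconnected

module Submission where

-- Label the n − 2 vertices other than the two leaves x, y by 0, …, n − 3 and put K = n − 3.
-- Edges between labels i, j < K get colour i + j mod K; an edge from label i < K to label K
-- or to a leaf gets colour 2i. For a vertex s of label below K, the edges from s to the other
-- non-leaf vertices then have pairwise distinct colours, and removing them leaves s attached
-- only to leaves hanging at s. At most one non-leaf vertex has label K, so every pair of
-- non-leaf vertices is split by such a cut, while a leaf is split off by its single edge.

open import Defs
open import Data.Bool using (Bool; true; false; _∧_; _∨_; if_then_else_)
open import Data.Bool.Properties using (∧-conicalˡ; ∧-conicalʳ; ∨-comm)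
open import Data.Fin as F using (Fin; toℕ; _≟_)
open import Data.Fin.Permutation using (Permutation′; _⟨$⟩ʳ_; _∘ₚ_; transpose)
import Data.Fin.Permutation.Components as PC
open import Data.Fin.Properties using (toℕ-injective; toℕ<n; toℕ-fromℕ; toℕ-fromℕ<; toℕ-inject₁)
open import Data.List using (tabulate)
open import Data.List.Properties using (map-tabulate)
open import Data.Nat using (ℕ; suc; _+_; _∸_; _<_; _≤_; _≥_; _<?_; NonZero; s≤s)
open import Data.Nat.DivMod using (_%_; _mod_; %-congˡ; [m+n]%n≡m%n; m<n⇒m%n≡m; m%n<n)
open import Data.Nat.ListAction using (sum)
open import Data.Nat.Properties hiding (_≟_)
open import Data.Product using (Σ; _×_; _,_)
open import Data.Sum using (_⊎_; inj₁; inj₂)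
open import Data.Unit using (tt)
open import Function using (_∘_; id)
open import Function.Bundles using (Injection)
open import Function.Properties.Inverse using (↔⇒↣)
open import Relation.Binary.PropositionalEquality
open import Relation.Nullary using (¬_; Dec; yes; no; does; contradiction)
open import Relation.Nullary.Decidable using (dec-true; dec-false; ¬?; _⊎-dec_; decidable-stable)
open import Relation.Unary using (Decidable)
open import Relation.Unary.Properties using (U?)

∨-≡-true⁻ : ∀ {a b} → a ∨ b ≡ true → a ≡ true ⊎ b ≡ true
∨-≡-true⁻ {true}  _ = inj₁ refl
∨-≡-true⁻ {false} e = inj₂ e

does≡true⇒ : ∀ {A : Set} (a? : Dec A) → does a? ≡ true → A
does≡true⇒ (yes a) _ = a

%-of-<2n : ∀ {m n} .{{_ : NonZero n}} → m < n + n → m % n ≡ m ⊎ m % n + n ≡ m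
%-of-<2n {m} {n} m<2n with m <? n
... | yes m<n = inj₁ (m<n⇒m%n≡m m<n)
... | no m≮n = inj₂ (begin
  m % n + n           ≡⟨ cong (_+ n) (%-congˡ (sym m∸n+n≡m')) ⟩
  (m ∸ n + n) % n + n ≡⟨ cong (_+ n) ([m+n]%n≡m%n (m ∸ n) n) ⟩
  (m ∸ n) % n + n     ≡⟨ cong (_+ n) (m<n⇒m%n≡m (m<n+o⇒m∸n<o m n m<2n)) ⟩
  m ∸ n + n           ≡⟨ m∸n+n≡m' ⟩
  m                   ∎)
  where
  open ≡-Reasoning
  m∸n+n≡m' : m ∸ n + n ≡ m
  m∸n+n≡m' = m∸n+n≡m (≮⇒≥ m≮n)

m+n≡m+o+p⇒n≮p : ∀ m {n o p} → m + n ≡ m + o + p → ¬ n < p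
m+n≡m+o+p⇒n≮p m {n} {o} {p} e n<p =
  m+n≮n o p (subst (_< p) (+-cancelˡ-≡ m n (o + p) (trans e (+-assoc m o p))) n<p)

+-cancelˡ-% : ∀ {i j j' n} .{{_ : NonZero n}} → i < n → j < n → j' < n →
              (i + j) % n ≡ (i + j') % n → j ≡ j'
+-cancelˡ-% {i} {j} {j'} {n} i<n j<n j'<n eq
  with %-of-<2n (+-mono-< i<n j<n) | %-of-<2n (+-mono-< i<n j'<n)
... | inj₁ r≡ | inj₁ r'≡ = +-cancelˡ-≡ i j j' (trans (sym r≡) (trans eq r'≡))
... | inj₂ r≡ | inj₂ r'≡ = +-cancelˡ-≡ i j j' (trans (sym r≡) (trans (cong (_+ n) eq) r'≡))
... | inj₁ r≡ | inj₂ r'≡ =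
  contradiction j'<n (m+n≡m+o+p⇒n≮p i (trans (sym r'≡) (cong (_+ n) (trans (sym eq) r≡))))
... | inj₂ r≡ | inj₁ r'≡ =
  contradiction j<n (m+n≡m+o+p⇒n≮p i (trans (sym r≡) (cong (_+ n) (trans eq r'≡))))

mod≡⇒%≡ : ∀ m m' {n} .{{_ : NonZero n}} → m mod n ≡ m' mod n → m % n ≡ m' % n
mod≡⇒%≡ m m' {n} e =
  trans (sym (toℕ-fromℕ< (m%n<n m n))) (trans (cong toℕ e) (toℕ-fromℕ< (m%n<n m' n)))

module LabelColouring (K : ℕ) .{{_ : NonZero K}} where

  -- A label ≥ K stands in for its partner, so an edge from label j < K to it gets colour 2j.
  standIn : ℕ → ℕ → ℕ
  standIn i j with i <? K
  ... | yes _ = i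
  ... | no  _ = j

  colour : ℕ → ℕ → ℕ
  colour i j = standIn i j + standIn j i

  colour-comm : ∀ i j → colour i j ≡ colour j i
  colour-comm i j = +-comm (standIn i j) (standIn j i)

  standIn-< : ∀ {i j} → i < K → standIn i j ≡ i
  standIn-< {i} i<K with i <? K
  ... | yes _ = refl
  ... | no i≮K = contradiction i<K i≮K

  colour-injectiveʳ : ∀ {i j j'} → i < K → j ≤ K → j' ≤ K → j ≢ i → j' ≢ i →
                      colour i j % K ≡ colour i j' % K → j ≡ j'
  colour-injectiveʳ {i} {j} {j'} i<K j≤K j'≤K j≢i j'≢i eq
    rewrite standIn-< {i} {j} i<K | standIn-< {i} {j'} i<K
    with j <? K | j' <? K
  ... | yes j<K | yes j'<K = +-cancelˡ-% i<K j<K j'<K eq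
  ... | yes j<K | no  _    = contradiction (+-cancelˡ-% i<K j<K i<K eq) j≢i
  ... | no  _   | yes j'<K = contradiction (+-cancelˡ-% i<K j'<K i<K (sym eq)) j'≢i
  ... | no  j≮K | no  j'≮K = trans (≤-antisym j≤K (≮⇒≥ j≮K)) (≤-antisym (≮⇒≥ j'≮K) j'≤K)

tabulate-≤-sum : ∀ {m} (g : Fin m → ℕ) t → g t ≤ sum (tabulate g)
tabulate-≤-sum g F.zero    = m≤m+n (g F.zero) _
tabulate-≤-sum g (F.suc t) = ≤-trans (tabulate-≤-sum (g ∘ F.suc) t) (m≤n+m _ (g F.zero))

tabulate-pair-≤-sum : ∀ {m} (g : Fin m → ℕ) {t t'} → t ≢ t' → g t + g t' ≤ sum (tabulate g)
tabulate-pair-≤-sum g {F.zero}  {F.zero}   t≢t' = contradiction refl t≢t'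
tabulate-pair-≤-sum g {F.zero}  {F.suc t'} _    = +-monoʳ-≤ (g F.zero) (tabulate-≤-sum (g ∘ F.suc) t')
tabulate-pair-≤-sum g {F.suc t} {F.zero}   _    =
  subst (_≤ sum (tabulate g)) (+-comm (g F.zero) (g (F.suc t)))
        (+-monoʳ-≤ (g F.zero) (tabulate-≤-sum (g ∘ F.suc) t))
tabulate-pair-≤-sum g {F.suc t} {F.suc t'} t≢t' =
  ≤-trans (tabulate-pair-≤-sum (g ∘ F.suc) (t≢t' ∘ cong F.suc)) (m≤n+m _ (g F.zero))

adj⇒≢ : ∀ {n} (G : Graph n) {s t} → adj G s t ≡ true → t ≢ s
adj⇒≢ G {s} st refl with () ← trans (sym st) (irrefl G s)

AtMostOneNeighbour : ∀ {n} → Graph n → Fin n → Set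
AtMostOneNeighbour G s = ∀ {t t'} → adj G s t ≡ true → adj G s t' ≡ true → t ≡ t'

degree≤1⇒AtMostOneNeighbour : ∀ {n} (G : Graph n) {s} → degree G s ≤ 1 → AtMostOneNeighbour G s
degree≤1⇒AtMostOneNeighbour {n} G {s} deg≤1 {t} {t'} st st' with t ≟ t'
... | yes t≡t' = t≡t'
... | no  t≢t' = contradiction (≤-trans two≤degree deg≤1) λ { (s≤s ()) }
  where
  count : Bool → ℕ
  count b = if b then 1 else 0
  two≤degree : 2 ≤ degree G s
  two≤degree = subst₂ _≤_ (cong₂ _+_ (cong count st) (cong count st'))
                          (cong sum (sym (map-tabulate id (count ∘ adj G s))))
                          (tabulate-pair-≤-sum (count ∘ adj G s) t≢t')

module _ {n : ℕ} {E : Fin n → Fin n → Set} where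

  Reach-closed : (P : Fin n → Set) → (∀ {a b} → P a → E a b → P b) →
                 ∀ {u v} → Reach E u v → P u → P v
  Reach-closed P closed here       Pu = Pu
  Reach-closed P closed (step e r) Pu = Reach-closed P closed r (closed Pu e)

  Reach-snoc : ∀ {u w v} → Reach E u w → E w v → Reach E u v
  Reach-snoc here       e = step e here
  Reach-snoc (step e r) e' = step e (Reach-snoc r e')

  Reach-sym : (∀ {a b} → E a b → E b a) → ∀ {u v} → Reach E u v → Reach E v u
  Reach-sym E-sym here       = here
  Reach-sym E-sym (step e r) = Reach-snoc (Reach-sym E-sym r) (E-sym e)

module _ {n : ℕ} where

  SameEdge-sym : ∀ {a b c d : Fin n} → SameEdge a b c d → SameEdge c d a b
  SameEdge-sym (inj₁ (refl , refl)) = inj₁ (refl , refl)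
  SameEdge-sym (inj₂ (refl , refl)) = inj₂ (refl , refl)

  SameEdge-trans : ∀ {a b c d e f : Fin n} → SameEdge a b c d → SameEdge c d e f → SameEdge a b e f
  SameEdge-trans (inj₁ (refl , refl)) q                    = q
  SameEdge-trans (inj₂ (refl , refl)) (inj₁ (refl , refl)) = inj₂ (refl , refl)
  SameEdge-trans (inj₂ (refl , refl)) (inj₂ (refl , refl)) = inj₁ (refl , refl)

module _ {n k : ℕ} {G : Graph n} (c : EdgeColoring G k) where

  col-SameEdge : ∀ {a b s t} → SameEdge a b s t → col c a b ≡ col c s t
  col-SameEdge (inj₁ (refl , refl)) = refl
  col-SameEdge (inj₂ (refl , refl)) = colSymm c _ _

  RainbowCut-sym : ∀ {R u v} → RainbowCut c R u v → RainbowCut c R v u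
  RainbowCut-sym {R} (rainbow , u↛v) = rainbow , u↛v ∘ Reach-sym MinusAdj-sym
    where
    MinusAdj-sym : ∀ {a b} → MinusAdj G R a b → MinusAdj G R b a
    MinusAdj-sym {a} {b} (ab , ab∉R) = trans (symm G b a) ab , trans (memSymm R b a) ab∉R

module _ {n : ℕ} (G : Graph n) (s : Fin n) {P : Fin n → Set} (P? : Decidable P) where

  leavesTowards : Fin n → Fin n → Bool
  leavesTowards a b = does (a ≟ s) ∧ does (P? b)

  edgesAt : EdgeSet G
  edgesAt = record
    { mem     = λ a b → adj G a b ∧ (leavesTowards a b ∨ leavesTowards b a)
    ; memSymm = λ a b → cong₂ _∧_ (symm G a b) (∨-comm (leavesTowards a b) (leavesTowards b a))
    ; memE    = λ a b → ∧-conicalˡ _ _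
    }

  edgesAt-complete : ∀ {t} → adj G s t ≡ true → P t → mem edgesAt s t ≡ true
  edgesAt-complete {t} st Pt
    rewrite st | dec-true (s ≟ s) refl | dec-true (P? t) Pt = refl

  edgesAt-sound : ∀ {a b} → mem edgesAt a b ≡ true →
                  Σ (Fin n) λ t → adj G s t ≡ true × P t × SameEdge a b s t
  edgesAt-sound {a} {b} ab∈R with ∨-≡-true⁻ (∧-conicalʳ (adj G a b) _ ab∈R)
  ... | inj₁ a→b with refl ← does≡true⇒ (a ≟ s) (∧-conicalˡ _ _ a→b) =
    b , ∧-conicalˡ _ _ ab∈R , does≡true⇒ (P? b) (∧-conicalʳ _ _ a→b) , inj₁ (refl , refl)
  ... | inj₂ b→a with refl ← does≡true⇒ (b ≟ s) (∧-conicalˡ _ _ b→a) =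
    a , trans (symm G s a) (∧-conicalˡ _ _ ab∈R) , does≡true⇒ (P? a) (∧-conicalʳ _ _ b→a) , inj₂ (refl , refl)

  edgesAt-rainbow : ∀ {k} (c : EdgeColoring G k) →
    (∀ {t t'} → adj G s t ≡ true → adj G s t' ≡ true → P t → P t' → col c s t ≡ col c s t' → t ≡ t') →
    Rainbow c edgesAt
  edgesAt-rainbow c injective a b a' b' ab∈R a'b'∈R same-col
    with edgesAt-sound ab∈R | edgesAt-sound a'b'∈R
  ... | t , st , Pt , ab≈st | t' , st' , Pt' , a'b'≈st' =
    SameEdge-trans ab≈st (SameEdge-sym (subst (SameEdge a' b' s) (sym t≡t') a'b'≈st'))
    where
    t≡t' : t ≡ t'
    t≡t' = injective st st' Pt Pt'
             (trans (sym (col-SameEdge c ab≈st)) (trans same-col (col-SameEdge c a'b'≈st')))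

  edgesAt-separates : (∀ {w} → adj G s w ≡ true → ¬ P w → AtMostOneNeighbour G w) →
                      ∀ {v} → P v → v ≢ s → ¬ Reach (MinusAdj G edgesAt) s v
  edgesAt-separates leaf {v} Pv v≢s s↝v = v∉Attached (Reach-closed Attached closed s↝v (inj₁ refl))
    where
    -- The neighbours of s kept in G − edgesAt are leaves, so s and they form a closed set.
    Attached : Fin n → Set
    Attached w = w ≡ s ⊎ (adj G s w ≡ true × ¬ P w)
    closed : ∀ {a b} → Attached a → MinusAdj G edgesAt a b → Attached b
    closed (inj₁ refl) (sb , sb∉R) = inj₂ (sb , λ Pb → contradiction (trans (sym (edgesAt-complete sb Pb)) sb∉R) λ ())
    closed {a} (inj₂ (sa , ¬Pa)) (ab , _) = inj₁ (sym (leaf sa ¬Pa (trans (symm G a s) sa) ab))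
    v∉Attached : ¬ Attached v
    v∉Attached (inj₁ v≡s)       = v≢s v≡s
    v∉Attached (inj₂ (_ , ¬Pv)) = ¬Pv Pv

module _ {m : ℕ} where

  transpose-matchˡ : ∀ (i j : Fin m) → PC.transpose i j i ≡ j
  transpose-matchˡ i j rewrite dec-true (i ≟ i) refl = refl

  transpose-mismatch : ∀ {i j w : Fin m} → w ≢ i → w ≢ j → PC.transpose i j w ≡ w
  transpose-mismatch {i} {j} {w} w≢i w≢j rewrite dec-false (w ≟ i) w≢i | dec-false (w ≟ j) w≢j = refl

  permutation-injective : ∀ (σ : Permutation′ m) {a b} → σ ⟨$⟩ʳ a ≡ σ ⟨$⟩ʳ b → a ≡ b
  permutation-injective σ = Injection.injective (↔⇒↣ σ)

module TwoLeaves {k : ℕ} (G : Graph (3 + suc k)) {x y : Fin (3 + suc k)} (x≢y : x ≢ y)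
                 (x-leaf : AtMostOneNeighbour G x) (y-leaf : AtMostOneNeighbour G y) where

  K : ℕ
  K = suc k

  open LabelColouring K

  Leaf : Fin (3 + K) → Set
  Leaf w = w ≡ x ⊎ w ≡ y

  leaf? : Decidable Leaf
  leaf? w = w ≟ x ⊎-dec w ≟ y

  Leaf⇒AtMostOneNeighbour : ∀ {w} → Leaf w → AtMostOneNeighbour G w
  Leaf⇒AtMostOneNeighbour (inj₁ refl) = x-leaf
  Leaf⇒AtMostOneNeighbour (inj₂ refl) = y-leaf

  last₁ last₂ : Fin (3 + K)
  last₁ = F.fromℕ (2 + K)
  last₂ = F.inject₁ (F.fromℕ (1 + K))

  σ : Permutation′ (3 + K)
  σ = transpose x last₁

  π : Permutation′ (3 + K)
  π = σ ∘ₚ transpose (σ ⟨$⟩ʳ y) last₂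

  π-y : π ⟨$⟩ʳ y ≡ last₂
  π-y = transpose-matchˡ (σ ⟨$⟩ʳ y) last₂

  π-x : π ⟨$⟩ʳ x ≡ last₁
  π-x = trans (cong (PC.transpose (σ ⟨$⟩ʳ y) last₂) (transpose-matchˡ x last₁))
              (transpose-mismatch σy≢last₁ last₁≢last₂)
    where
    σy≢last₁ : last₁ ≢ σ ⟨$⟩ʳ y
    σy≢last₁ e = x≢y (permutation-injective σ (trans (transpose-matchˡ x last₁) e))
    last₁≢last₂ : last₁ ≢ last₂
    last₁≢last₂ e = 1+n≢n (trans (sym (toℕ-fromℕ (2 + K)))
                                 (trans (cong toℕ e) (trans (toℕ-inject₁ _) (toℕ-fromℕ (1 + K)))))

  label : Fin (3 + K) → ℕ
  label w = toℕ (π ⟨$⟩ʳ w)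

  label-injective : ∀ {a b} → label a ≡ label b → a ≡ b
  label-injective = permutation-injective π ∘ toℕ-injective

  label-≤ : ∀ {w} → ¬ Leaf w → label w ≤ K
  label-≤ {w} ¬Lw = ≤-pred (≤∧≢⇒< (≤-pred (≤∧≢⇒< (≤-pred (toℕ<n (π ⟨$⟩ʳ w))) ≢2+K)) ≢1+K)
    where
    ≢2+K : label w ≢ 2 + K
    ≢2+K e = ¬Lw (inj₁ (label-injective (trans e (trans (sym (toℕ-fromℕ (2 + K))) (cong toℕ (sym π-x))))))
    ≢1+K : label w ≢ 1 + K
    ≢1+K e = ¬Lw (inj₂ (label-injective (trans e (trans (sym (trans (toℕ-inject₁ _) (toℕ-fromℕ (1 + K))))
                                                           (cong toℕ (sym π-y))))))

  colouring : EdgeColoring G K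
  colouring = record
    { col     = λ u w → colour (label u) (label w) mod K
    ; colSymm = λ u w → cong (_mod K) (colour-comm (label u) (label w))
    }

  CutBetween : Fin (3 + K) → Fin (3 + K) → Set
  CutBetween u v = Σ (EdgeSet G) λ R → RainbowCut colouring R u v

  CutBetween-sym : ∀ {u v} → CutBetween u v → CutBetween v u
  CutBetween-sym (R , cut) = R , RainbowCut-sym colouring {R} cut

  leafCut : ∀ {u v} → Leaf u → v ≢ u → CutBetween u v
  leafCut {u} Lu v≢u =
    edgesAt G u U? ,
    edgesAt-rainbow G u U? colouring (λ ut ut' _ _ _ → Leaf⇒AtMostOneNeighbour Lu ut ut') ,
    edgesAt-separates G u U? (λ _ ¬⊤ → contradiction tt ¬⊤) tt v≢u

  coreCut : ∀ {s v} → label s < K → ¬ Leaf v → v ≢ s → CutBetween s v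
  coreCut {s} ℓs<K ¬Lv v≢s =
    edgesAt G s (¬? ∘ leaf?) ,
    edgesAt-rainbow G s (¬? ∘ leaf?) colouring row-injective ,
    edgesAt-separates G s (¬? ∘ leaf?) leaves-at-s ¬Lv v≢s
    where
    row-injective : ∀ {t t'} → adj G s t ≡ true → adj G s t' ≡ true → ¬ Leaf t → ¬ Leaf t' →
                    col colouring s t ≡ col colouring s t' → t ≡ t'
    row-injective {t} {t'} st st' ¬Lt ¬Lt' same-col =
      label-injective (colour-injectiveʳ ℓs<K (label-≤ ¬Lt) (label-≤ ¬Lt')
                        (adj⇒≢ G st ∘ label-injective) (adj⇒≢ G st' ∘ label-injective)
                        (mod≡⇒%≡ (colour (label s) (label t)) (colour (label s) (label t')) same-col))
    leaves-at-s : ∀ {w} → adj G s w ≡ true → ¬ ¬ Leaf w → AtMostOneNeighbour G w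
    leaves-at-s {w} _ ¬¬Lw = Leaf⇒AtMostOneNeighbour (decidable-stable (leaf? w) ¬¬Lw)

  rainbowDisconnected : RainbowDisconnected colouring
  rainbowDisconnected u v u≢v with leaf? u | leaf? v
  ... | yes Lu | _      = leafCut Lu (u≢v ∘ sym)
  ... | no _   | yes Lv = CutBetween-sym (leafCut Lv u≢v)
  ... | no ¬Lu | no ¬Lv with label u <? K
  ...   | yes ℓu<K = coreCut ℓu<K ¬Lv (u≢v ∘ sym)
  ...   | no  ℓu≮K = CutBetween-sym (coreCut ℓv<K ¬Lu u≢v)
    where
    ℓv<K : label v < K
    ℓv<K = ≤∧≢⇒< (label-≤ ¬Lv) λ ℓv≡K →
             u≢v (label-injective (trans (≤-antisym (label-≤ ¬Lu) (≮⇒≥ ℓu≮K)) (sym ℓv≡K)))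

rd≤-two-leaves : ∀ {k} (G : Graph (3 + suc k)) {x y} → x ≢ y →
                 AtMostOneNeighbour G x → AtMostOneNeighbour G y → rd≤ G (suc k)
rd≤-two-leaves G x≢y x-leaf y-leaf = colouring , rainbowDisconnected
  where open TwoLeaves G x≢y x-leaf y-leaf

lemma16 : (n : ℕ) → n ≥ 4 → (G : Graph n) → Connected G → ComplementConnected G →
    Σ (Fin n) (λ x → Σ (Fin n) (λ y → (x ≢ y) × (degree G x ≡ 1) × (degree G y ≡ 1))) →
    rd≤ G (n ∸ 3)
lemma16 _ (s≤s (s≤s (s≤s (s≤s _)))) G _ _ (x , y , x≢y , deg-x≡1 , deg-y≡1) =
  rd≤-two-leaves G x≢y (degree≤1⇒AtMostOneNeighbour G (≤-reflexive deg-x≡1))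
                       (degree≤1⇒AtMostOneNeighbour G (≤-reflexive deg-y≡1))
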